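{- Let $\langle R,\sim\rangle$ be the Rado graph. For each maximal antichain $\mathcal A$ in the poset $\langle\mathbb P(R),\subset\rangle$ and each finite set $F_0\subset R$ there is $S\in\mathbb P(R)$ such that $F_0\subset S$ and for every $H\subset F_0$ there is $A\in\mathcal A$ with $S^{F_0}_H\subset A$.
   Context: The Rado graph $\langle R,\sim\rangle$ is the unique countable graph such that $R^H_K\neq\emptyset$ for all finite $K\subset H\subset R$, where $R^H_K=\{v\in R\setminus H:\forall k\in K\,(v\sim k)\wedge\forall h\in H\setminus K\,(v\not\sim h)\}$. For $S\subset R$ and finite $K\subset H$, $S^H_K=S\cap R^H_K$. $\mathbb P(R)$ is the set of subsets of $R$ whose induced subgraph is isomorphic to $R$. Two elements of $\mathbb P(R)$ are compatible iff their intersection contains an element of $\mathbb P(R)$. -}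

module Defs where

open import Level using (0ℓ)
open import Data.Nat using (ℕ)
open import Data.Product using (Σ; ∃; ∃-syntax; _×_; _,_)
open import Data.List using (List)
open import Data.List.Membership.Propositional using (_∈_; _∉_)
open import Relation.Nullary using (¬_)
open import Relation.Unary using (Pred; _⊆_; _∩_; _≐_)
open import Relation.Binary using (Rel; Symmetric; Irreflexive; Decidable)
open import Relation.Binary.PropositionalEquality using (_≡_)
open import Function.Bundles using (_↔_; _⇔_)

record CountableGraph : Set₁ where
  field
    V           : Set
    _∼_         : Rel V 0ℓ
    ∼-sym       : Symmetric _∼_
    ∼-irrefl    : Irreflexive _≡_ _∼_
    ∼-dec       : Decidable _∼_
    enumeration : ℕ ↔ V

module _ (G : CountableGraph) where
  open CountableGraph G

  _⊆ₗ_ : List V → List V → Set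
  K ⊆ₗ H = ∀ {x} → x ∈ K → x ∈ H

  Ext : List V → List V → Pred V 0ℓ
  Ext H K v = v ∉ H
            × (∀ {k} → k ∈ K → v ∼ k)
            × (∀ {h} → h ∈ H → h ∉ K → ¬ (v ∼ h))

  IsRado : Set
  IsRado = ∀ (K H : List V) → K ⊆ₗ H → ∃[ v ] Ext H K v

  Restrict : Pred V 0ℓ → List V → List V → Pred V 0ℓ
  Restrict S H K = S ∩ Ext H K

  IsCopy : Pred V 0ℓ → Set
  IsCopy S = Σ (V → V) λ f →
               (∀ x → S (f x))
             × (∀ x y → f x ≡ f y → x ≡ y)
             × (∀ s → S s → ∃[ x ] f x ≡ s)
             × (∀ x y → (x ∼ y) ⇔ (f x ∼ f y))

  Compatible : Pred V 0ℓ → Pred V 0ℓ → Set₁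
  Compatible A B = ∃[ C ] IsCopy C × C ⊆ (A ∩ B)

  -- maximal antichain in ⟨ℙ(R), ⊂⟩ (forcing sense: pairwise incompatible, maximal)
  IsMaximalAntichain : Pred (Pred V 0ℓ) 0ℓ → Set₁
  IsMaximalAntichain 𝒜 =
      (∀ {A} → 𝒜 A → IsCopy A)
    × (∀ {A B} → 𝒜 A → 𝒜 B → ¬ (A ≐ B) → ¬ Compatible A B)
    × (∀ P → IsCopy P → ∃[ A ] 𝒜 A × Compatible A P)

-- Let Q list F₀ without repetitions. The vertices outside Q with a fixed adjacency pattern
-- (type) ρ to Q form classes that the extension property makes jointly extensible, so a forth
-- argument embeds R into all of them at once by maps Ψ ρ that are mutually independent:
-- Ψ ρ x ∼ Ψ σ y iff x ∼ y, for x ≠ y. Maximality of 𝒜 turns every embedding g into one, g ∘ κ,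
-- whose image lies in a member of 𝒜; doing this for the finitely many types in turn gives one κ
-- with every Ψ ρ ∘ κ landing in some A ρ ∈ 𝒜. The copy S is the image of the map fixing Q and
-- sending x ∉ Q to Ψ (type x) (κ x); its part S^{F₀}_H lies in the image of Ψ ρ ∘ κ for the
-- type ρ that H prescribes, hence in A ρ.
module Submission where

open import Defs
open import Level using (0ℓ)
open import Data.Bool using (Bool; true; false; T)
open import Data.Nat using (ℕ; zero; suc; _<_; _≟_)
open import Data.Nat.Properties using (<-cmp; m<1+n⇒m<n∨m≡n)
open import Data.Product using (∃-syntax; ∃₂; _×_; _,_; proj₁; proj₂)
open import Data.Product.Properties using (,-injectiveˡ; ,-injectiveʳ)
open import Data.Sum using (inj₁; inj₂)
open import Data.Empty using (⊥-elim)
open import Data.List using (List; []; _∷_; _++_; map; filter; length; deduplicate; [_])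
open import Data.List.Relation.Unary.All using (All; []; _∷_; universal)
import Data.List.Relation.Unary.All as All
open import Data.List.Relation.Unary.All.Properties using (++⁺; map⁺)
open import Data.List.Relation.Unary.Any using (here; there)
import Data.List.Relation.Unary.Any as Any
open import Data.List.Relation.Unary.Unique.Propositional using (Unique; []; _∷_)
open import Data.List.Relation.Unary.Unique.DecPropositional.Properties using (deduplicate-!)
open import Data.List.Membership.Propositional using (_∈_; _∉_)
open import Data.List.Membership.Propositional.Properties
  using (∈-map⁺; ∈-map⁻; ∈-++⁺ˡ; ∈-++⁺ʳ; ∈-++⁻; ∈-filter⁺; ∈-filter⁻; ∈-deduplicate⁺; ∈-deduplicate⁻)
import Data.List.Membership.DecPropositional as DecMembership
open import Data.Vec using (Vec; []; _∷_; fromList)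
import Data.Vec as Vec
open import Data.Vec.Properties using (∷-injectiveˡ; ∷-injectiveʳ)
open import Function using (_∘_; id)
open import Function.Bundles using (Inverse; _⇔_; mk⇔)
open import Function.Definitions using (Injective)
open import Function.Properties.Inverse using (↔-sym; ↔⇒↣)
open import Relation.Binary.Definitions using (DecidableEquality; tri<; tri≈; tri>)
open import Relation.Binary.PropositionalEquality
  using (_≡_; _≢_; refl; sym; trans; cong; cong₂; subst; module ≡-Reasoning)
open import Relation.Nullary using (Dec; yes; no; does; proof)
open import Relation.Nullary.Reflects using (Reflects; invert)
open import Relation.Nullary.Decidable using (dec-true; dec-false; does-⇔; via-injection; T?)
open import Relation.Unary using (Pred; _⊆_)

allBitVecs : (k : ℕ) → List (Vec Bool k)
allBitVecs zero    = [ [] ]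
allBitVecs (suc k) = map (true ∷_) (allBitVecs k) ++ map (false ∷_) (allBitVecs k)

∈-allBitVecs : ∀ {k} (ρ : Vec Bool k) → ρ ∈ allBitVecs k
∈-allBitVecs []          = here refl
∈-allBitVecs (true ∷ ρ)  = ∈-++⁺ˡ (∈-map⁺ (true ∷_) (∈-allBitVecs ρ))
∈-allBitVecs (false ∷ ρ) = ∈-++⁺ʳ _ (∈-map⁺ (false ∷_) (∈-allBitVecs ρ))

module RadoCopies (G : CountableGraph) where
  open CountableGraph G

  e : ℕ → V
  e = Inverse.to enumeration

  ι : V → ℕ
  ι = Inverse.from enumeration

  e∘ι : ∀ x → e (ι x) ≡ x
  e∘ι = Inverse.strictlyInverseˡ enumeration

  _≟V_ : DecidableEquality V
  _≟V_ = via-injection (↔⇒↣ (↔-sym enumeration)) _≟_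

  open DecMembership _≟V_ using (_∈?_)

  adj : V → V → Bool
  adj x y = does (∼-dec x y)

  adj-sym : ∀ x y → adj x y ≡ adj y x
  adj-sym x y = does-⇔ (mk⇔ ∼-sym ∼-sym) (∼-dec x y) (∼-dec y x)

  adj-irrefl : ∀ x → adj x x ≡ false
  adj-irrefl x = dec-false (∼-dec x x) (∼-irrefl refl)

  adj≡true⇒∼ : ∀ {x y} → adj x y ≡ true → x ∼ y
  adj≡true⇒∼ {x} {y} eq = invert (subst (Reflects (x ∼ y)) eq (proof (∼-dec x y)))

  adj-≡⇒⇔ : ∀ {x y a b} → adj x y ≡ adj a b → (x ∼ y) ⇔ (a ∼ b)
  adj-≡⇒⇔ {x} {y} {a} {b} eq =
    mk⇔ (λ x∼y → adj≡true⇒∼ (trans (sym eq) (dec-true (∼-dec x y) x∼y)))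
        (λ a∼b → adj≡true⇒∼ (trans eq (dec-true (∼-dec a b) a∼b)))

  Realises : V → (V → Bool) → List V → Set
  Realises w P L = ∀ {x} → x ∈ L → adj w x ≡ P x

  record IsEmbedding (f : V → V) : Set where
    field
      adj-preserving : ∀ x y → adj (f x) (f y) ≡ adj x y
      injective      : Injective _≡_ _≡_ f

  id-isEmbedding : IsEmbedding id
  id-isEmbedding = record { adj-preserving = λ _ _ → refl ; injective = id }

  ∘-isEmbedding : ∀ {f g} → IsEmbedding f → IsEmbedding g → IsEmbedding (f ∘ g)
  ∘-isEmbedding {f} {g} f-emb g-emb = record
    { adj-preserving = λ x y →
        trans (IsEmbedding.adj-preserving f-emb (g x) (g y)) (IsEmbedding.adj-preserving g-emb x y)
    ; injective      = IsEmbedding.injective g-emb ∘ IsEmbedding.injective f-emb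
    }

  Image : (V → V) → Pred V 0ℓ
  Image f s = ∃[ x ] f x ≡ s

  image-isCopy : ∀ {f} → IsEmbedding f → IsCopy G (Image f)
  image-isCopy {f} f-emb =
    f , (λ x → x , refl) , (λ x y → injective) , (λ _ s∈ → s∈) ,
    λ x y → adj-≡⇒⇔ (sym (adj-preserving x y))
    where open IsEmbedding f-emb

  record IsJointEmbedding {I : Set} (Φ : I → V → V) : Set where
    field
      adj-preserving : ∀ i j {x y} → x ≢ y → adj (Φ i x) (Φ j y) ≡ adj x y
      injective      : ∀ i j {x y} → Φ i x ≡ Φ j y → x ≡ y

    isEmbedding : ∀ i → IsEmbedding (Φ i)
    isEmbedding i = record { adj-preserving = preserving ; injective = injective i i }
      where
      preserving : ∀ x y → adj (Φ i x) (Φ i y) ≡ adj x y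
      preserving x y with x ≟V y
      ... | yes refl = trans (adj-irrefl (Φ i x)) (sym (adj-irrefl x))
      ... | no x≢y   = adj-preserving i i x≢y

  ∘-isJointEmbedding : ∀ {I : Set} {Φ : I → V → V} {κ} →
    IsJointEmbedding Φ → IsEmbedding κ → IsJointEmbedding (λ i → Φ i ∘ κ)
  ∘-isJointEmbedding {κ = κ} Φ-joint κ-emb = record
    { adj-preserving = λ i j {x} {y} x≢y →
        trans (Φ.adj-preserving i j (x≢y ∘ K.injective)) (K.adj-preserving x y)
    ; injective      = λ i j → K.injective ∘ Φ.injective i j
    }
    where
    module Φ = IsJointEmbedding Φ-joint
    module K = IsEmbedding κ-emb

  module Absorption (𝒜 : Pred (Pred V 0ℓ) 0ℓ)
                    (predense : ∀ P → IsCopy G P → ∃[ A ] (𝒜 A × Compatible G A P)) where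

    absorb : ∀ {g} → IsEmbedding g →
      ∃[ κ ] (IsEmbedding κ × ∃[ A ] (𝒜 A × (∀ x → A (g (κ x)))))
    absorb {g} g-emb with predense (Image g) (image-isCopy g-emb)
    ... | A , A∈𝒜 , C , (h , h∈C , h-injective , _ , h-adj) , C⊆A∩Image =
      κ , κ-emb , A , A∈𝒜 , λ x → subst A (sym (g∘κ≡h x)) (proj₁ (C⊆A∩Image (h∈C x)))
      where
      open ≡-Reasoning
      κ : V → V
      κ x = proj₁ (proj₂ (C⊆A∩Image (h∈C x)))

      g∘κ≡h : ∀ x → g (κ x) ≡ h x
      g∘κ≡h x = proj₂ (proj₂ (C⊆A∩Image (h∈C x)))

      κ-emb : IsEmbedding κ
      κ-emb = record
        { adj-preserving = λ x y → begin
            adj (κ x) (κ y)         ≡⟨ sym (IsEmbedding.adj-preserving g-emb (κ x) (κ y)) ⟩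
            adj (g (κ x)) (g (κ y)) ≡⟨ cong₂ adj (g∘κ≡h x) (g∘κ≡h y) ⟩
            adj (h x) (h y)         ≡⟨ sym (does-⇔ (h-adj x y) (∼-dec x y) (∼-dec (h x) (h y))) ⟩
            adj x y                 ∎
        ; injective = λ {x} {y} κx≡κy →
            h-injective x y (trans (sym (g∘κ≡h x)) (trans (cong g κx≡κy) (g∘κ≡h y)))
        }

    absorbAll : ∀ {I : Set} {Φ : I → V → V} → (∀ i → IsEmbedding (Φ i)) → (is : List I) →
      ∃[ κ ] (IsEmbedding κ × (∀ {i} → i ∈ is → ∃[ A ] (𝒜 A × (∀ x → A (Φ i (κ x))))))
    absorbAll Φ-emb [] = id , id-isEmbedding , λ ()
    absorbAll {Φ = Φ} Φ-emb (i ∷ is) with absorbAll Φ-emb is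
    ... | κ₁ , κ₁-emb , absorbed with absorb (∘-isEmbedding (Φ-emb i) κ₁-emb)
    ...   | κ₂ , κ₂-emb , A , A∈𝒜 , Φiκ∈A = κ₁ ∘ κ₂ , ∘-isEmbedding κ₁-emb κ₂-emb , absorbed′
      where
      absorbed′ : ∀ {j} → j ∈ i ∷ is → ∃[ A ] (𝒜 A × (∀ x → A (Φ j (κ₁ (κ₂ x)))))
      absorbed′ (here refl) = A , A∈𝒜 , Φiκ∈A
      absorbed′ (there j∈) with absorbed j∈
      ... | A′ , A′∈𝒜 , Φjκ∈A′ = A′ , A′∈𝒜 , Φjκ∈A′ ∘ κ₂

  JointlyExtensible : {I : Set} → (I → Pred V 0ℓ) → Set
  JointlyExtensible {I} Y = ∀ i (L : List V) (P : V → Bool) → All (λ x → ∃[ j ] Y j x) L →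
    ∃[ w ] (Y i w × w ∉ L × Realises w P L)

  -- A forth argument run for all indices at once: ψ n i ∈ Y i plays the role of e n. The
  -- history tags each earlier choice with its stage m, so that ψ n i can be chosen to
  -- realise over it the adjacencies of e n to the corresponding e m.
  module Forth {I : Set} (indices : List I) (∈-indices : ∀ i → i ∈ indices)
               (Y : I → Pred V 0ℓ) (extensible : JointlyExtensible Y) where

    stageOf : List (V × ℕ) → V → ℕ
    stageOf []            x = 0
    stageOf ((w , m) ∷ h) x with x ≟V w
    ... | yes _ = m
    ... | no _  = stageOf h x

    stageOf-∈ : ∀ h {x} → x ∈ map proj₁ h → (x , stageOf h x) ∈ h
    stageOf-∈ ((w , m) ∷ h) {x} x∈ with x ≟V w
    ... | yes refl = here refl
    ... | no x≢w   = there (stageOf-∈ h (Any.tail x≢w x∈))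

    mutual
      history : ℕ → List (V × ℕ)
      history zero    = []
      history (suc n) = map (λ i → ψ n i , n) indices ++ history n

      choice : ∀ n i → ∃[ w ] (Y i w × w ∉ map proj₁ (history n)
                              × Realises w (λ x → adj (e n) (e (stageOf (history n) x))) (map proj₁ (history n)))
      choice n i = extensible i _ _ (map⁺ (history-covered n))

      ψ : ℕ → I → V
      ψ n i = proj₁ (choice n i)

      history-covered : ∀ n → All (λ p → ∃[ j ] Y j (proj₁ p)) (history n)
      history-covered zero    = []
      history-covered (suc n) = ++⁺ (map⁺ (universal (λ i → i , proj₁ (proj₂ (choice n i))) indices))
                                    (history-covered n)

    ψ∈Y : ∀ n i → Y i (ψ n i)
    ψ∈Y n i = proj₁ (proj₂ (choice n i))

    history-∋ : ∀ {m n} j → m < n → (ψ m j , m) ∈ history n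
    history-∋ {m} {suc n} j m<1+n with m<1+n⇒m<n∨m≡n m<1+n
    ... | inj₁ m<n  = ∈-++⁺ʳ _ (history-∋ j m<n)
    ... | inj₂ refl = ∈-++⁺ˡ (∈-map⁺ (λ i → ψ n i , n) (∈-indices j))

    history-∈ : ∀ n {p} → p ∈ history n → ∃₂ λ m j → p ≡ (ψ m j , m)
    history-∈ (suc n) p∈ with ∈-++⁻ (map (λ i → ψ n i , n) indices) p∈
    ... | inj₁ p∈new = let (j , _ , p≡) = ∈-map⁻ (λ i → ψ n i , n) p∈new in n , j , p≡
    ... | inj₂ p∈old = history-∈ n p∈old

    ψ-fresh : ∀ {m n} i j → m < n → ψ n i ≢ ψ m j
    ψ-fresh {n = n} i j m<n ψni≡ψmj =
      proj₁ (proj₂ (proj₂ (choice n i)))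
        (subst (_∈ map proj₁ (history n)) (sym ψni≡ψmj) (∈-map⁺ proj₁ (history-∋ j m<n)))

    ψ-stage-injective : ∀ {m n i j} → ψ n i ≡ ψ m j → n ≡ m
    ψ-stage-injective {m} {n} {i} {j} eq with <-cmp n m
    ... | tri< n<m _ _ = ⊥-elim (ψ-fresh j i n<m (sym eq))
    ... | tri≈ _ n≡m _ = n≡m
    ... | tri> _ _ m<n = ⊥-elim (ψ-fresh i j m<n eq)

    stageOf-history : ∀ {m n} j → m < n → stageOf (history n) (ψ m j) ≡ m
    stageOf-history {m} {n} j m<n
      with history-∈ n (stageOf-∈ (history n) (∈-map⁺ proj₁ (history-∋ j m<n)))
    ... | _ , _ , eq = trans (,-injectiveʳ eq) (sym (ψ-stage-injective (,-injectiveˡ eq)))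

    ψ-adj : ∀ {m n} i j → m < n → adj (ψ n i) (ψ m j) ≡ adj (e n) (e m)
    ψ-adj {m} {n} i j m<n =
      trans (proj₂ (proj₂ (proj₂ (choice n i))) (∈-map⁺ proj₁ (history-∋ j m<n)))
            (cong (λ k → adj (e n) (e k)) (stageOf-history j m<n))

    ψ-adj-≢ : ∀ {m n} i j → m ≢ n → adj (ψ n i) (ψ m j) ≡ adj (e n) (e m)
    ψ-adj-≢ {m} {n} i j m≢n with <-cmp m n
    ... | tri< m<n _ _ = ψ-adj i j m<n
    ... | tri≈ _ m≡n _ = ⊥-elim (m≢n m≡n)
    ... | tri> _ _ n<m = trans (adj-sym (ψ n i) (ψ m j)) (trans (ψ-adj j i n<m) (adj-sym (e m) (e n)))

    Ψ : I → V → V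
    Ψ i x = ψ (ι x) i

    Ψ-isJointEmbedding : IsJointEmbedding Ψ
    Ψ-isJointEmbedding = record
      { adj-preserving = λ i j {x} {y} x≢y →
          trans (ψ-adj-≢ i j (x≢y ∘ sym ∘ ι-injective)) (cong₂ adj (e∘ι x) (e∘ι y))
      ; injective = λ i j → ι-injective ∘ ψ-stage-injective
      }
      where
      ι-injective : ∀ {x y} → ι x ≡ ι y → x ≡ y
      ι-injective {x} {y} eq = trans (sym (e∘ι x)) (trans (cong e eq) (e∘ι y))

  type : (Q : List V) → V → Vec Bool (length Q)
  type Q v = Vec.map (adj v) (fromList Q)

  TypeClass : (Q : List V) → Vec Bool (length Q) → Pred V 0ℓ
  TypeClass Q ρ v = v ∉ Q × type Q v ≡ ρ

  type-≡⇒adj-≡ : ∀ Q {v w x} → type Q v ≡ type Q w → x ∈ Q → adj v x ≡ adj w x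
  type-≡⇒adj-≡ (q ∷ Q) eq (here refl) = ∷-injectiveˡ eq
  type-≡⇒adj-≡ (q ∷ Q) eq (there x∈) = type-≡⇒adj-≡ Q (∷-injectiveʳ eq) x∈

  memberType : (Q : List V) → List V → Vec Bool (length Q)
  memberType Q H = Vec.map (λ q → does (q ∈? H)) (fromList Q)

  Ext⇒type≡memberType : ∀ {F H s} Q → (∀ {q} → q ∈ Q → q ∈ F) → Ext G F H s →
    type Q s ≡ memberType Q H
  Ext⇒type≡memberType []      Q⊆F ext = refl
  Ext⇒type≡memberType {H = H} {s} (q ∷ Q) Q⊆F ext@(_ , adj-K , nonadj-H∖K) =
    cong₂ _∷_ head (Ext⇒type≡memberType Q (Q⊆F ∘ there) ext)
    where
    head : adj s q ≡ does (q ∈? H)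
    head with q ∈? H
    ... | yes q∈H = dec-true (∼-dec s q) (adj-K q∈H)
    ... | no q∉H  = dec-false (∼-dec s q) (nonadj-H∖K (Q⊆F (here refl)) q∉H)

  override : (Q : List V) → Vec Bool (length Q) → (V → Bool) → V → Bool
  override []      []      P x = P x
  override (q ∷ Q) (b ∷ ρ) P x with x ≟V q
  ... | yes _ = b
  ... | no _  = override Q ρ P x

  override-here : ∀ q Q b ρ P → override (q ∷ Q) (b ∷ ρ) P q ≡ b
  override-here q Q b ρ P with q ≟V q
  ... | yes _   = refl
  ... | no q≢q  = ⊥-elim (q≢q refl)

  override-there : ∀ q Q b ρ P {x} → x ≢ q → override (q ∷ Q) (b ∷ ρ) P x ≡ override Q ρ P x
  override-there q Q b ρ P {x} x≢q with x ≟V q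
  ... | yes x≡q = ⊥-elim (x≢q x≡q)
  ... | no _    = refl

  override-∉ : ∀ Q ρ P {x} → x ∉ Q → override Q ρ P x ≡ P x
  override-∉ []      []      P x∉ = refl
  override-∉ (q ∷ Q) (b ∷ ρ) P x∉ =
    trans (override-there q Q b ρ P (x∉ ∘ here)) (override-∉ Q ρ P (x∉ ∘ there))

  realises-override⇒type : ∀ {Q} → Unique Q → ∀ ρ P {w} → Realises w (override Q ρ P) Q → type Q w ≡ ρ
  realises-override⇒type []              []      P r = refl
  realises-override⇒type {q ∷ Q} (q≢Q ∷ uQ) (b ∷ ρ) P r =
    cong₂ _∷_ (trans (r (here refl)) (override-here q Q b ρ P))
              (realises-override⇒type uQ ρ P λ x∈ →
                 trans (r (there x∈)) (override-there q Q b ρ P λ x≡q → All.lookup q≢Q x∈ (sym x≡q)))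

  module Extension (rado : IsRado G) where

    rado-realises : (L : List V) (P : V → Bool) → ∃[ w ] (w ∉ L × Realises w P L)
    rado-realises L P with rado (filter (T? ∘ P) L) L (proj₁ ∘ ∈-filter⁻ (T? ∘ P) {xs = L})
    ... | w , w∉L , adj-K , nonadj-L∖K = w , w∉L , realises
      where
      realises : Realises w P L
      realises {x} x∈L with P x in Px
      ... | true  = dec-true (∼-dec w x) (adj-K (∈-filter⁺ (T? ∘ P) x∈L (subst T (sym Px) _)))
      ... | false = dec-false (∼-dec w x) (nonadj-L∖K x∈L λ x∈K →
                      subst T Px (proj₂ (∈-filter⁻ (T? ∘ P) {xs = L} x∈K)))

    typeClass-jointlyExtensible : ∀ {Q} → Unique Q → JointlyExtensible (TypeClass Q)
    typeClass-jointlyExtensible {Q} uQ ρ L P covered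
      with rado-realises (L ++ Q) (override Q ρ P)
    ... | w , w∉L++Q , realises =
      w , (w∉L++Q ∘ ∈-++⁺ʳ L , realises-override⇒type uQ ρ P (realises ∘ ∈-++⁺ʳ L))
        , w∉L++Q ∘ ∈-++⁺ˡ
        , λ x∈L → trans (realises (∈-++⁺ˡ x∈L))
                        (override-∉ Q ρ P (proj₁ (proj₂ (All.lookup covered x∈L))))

  record AbsorbingTypedEmbedding (𝒜 : Pred (Pred V 0ℓ) 0ℓ) (Q : List V) : Set₁ where
    field
      Φ         : Vec Bool (length Q) → V → V
      joint     : IsJointEmbedding Φ
      typed     : ∀ ρ x → TypeClass Q ρ (Φ ρ x)
      absorbing : ∀ ρ → ∃[ A ] (𝒜 A × (∀ x → A (Φ ρ x)))

  absorbingTypedEmbedding : IsRado G → (𝒜 : Pred (Pred V 0ℓ) 0ℓ) →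
    (∀ P → IsCopy G P → ∃[ A ] (𝒜 A × Compatible G A P)) →
    ∀ {Q} → Unique Q → AbsorbingTypedEmbedding 𝒜 Q
  absorbingTypedEmbedding rado 𝒜 predense {Q} uQ =
    let (κ , κ-emb , absorbed) = absorbAll (IsJointEmbedding.isEmbedding Ψ-isJointEmbedding) types in
    record
      { Φ         = λ ρ → Ψ ρ ∘ κ
      ; joint     = ∘-isJointEmbedding Ψ-isJointEmbedding κ-emb
      ; typed     = λ ρ x → ψ∈Y (ι (κ x)) ρ
      ; absorbing = absorbed ∘ ∈-allBitVecs
      }
    where
    open Absorption 𝒜 predense
    open Extension rado

    types : List (Vec Bool (length Q))
    types = allBitVecs (length Q)

    open Forth types ∈-allBitVecs (TypeClass Q) (typeClass-jointlyExtensible uQ)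

  module Gluing (Q : List V) {Φ : Vec Bool (length Q) → V → V} (Φ-joint : IsJointEmbedding Φ)
                (Φ-typed : ∀ ρ x → TypeClass Q ρ (Φ ρ x)) where

    glue : V → V
    glue x with x ∈? Q
    ... | yes _ = x
    ... | no _  = Φ (type Q x) x

    glue-∈ : ∀ {x} → x ∈ Q → glue x ≡ x
    glue-∈ {x} x∈Q with x ∈? Q
    ... | yes _   = refl
    ... | no x∉Q  = ⊥-elim (x∉Q x∈Q)

    glue-∉ : ∀ {x} → x ∉ Q → glue x ≡ Φ (type Q x) x
    glue-∉ {x} x∉Q with x ∈? Q
    ... | yes x∈Q = ⊥-elim (x∉Q x∈Q)
    ... | no _    = refl

    glue-adj-mixed : ∀ {x y} → x ∈ Q → y ∉ Q → adj (glue x) (glue y) ≡ adj x y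
    glue-adj-mixed {x} {y} x∈Q y∉Q = begin
      adj (glue x) (glue y)           ≡⟨ cong₂ adj (glue-∈ x∈Q) (glue-∉ y∉Q) ⟩
      adj x (Φ (type Q y) y)          ≡⟨ adj-sym x _ ⟩
      adj (Φ (type Q y) y) x          ≡⟨ type-≡⇒adj-≡ Q (proj₂ (Φ-typed (type Q y) y)) x∈Q ⟩
      adj y x                         ≡⟨ adj-sym y x ⟩
      adj x y                         ∎
      where open ≡-Reasoning

    glue-isEmbedding : IsEmbedding glue
    glue-isEmbedding = record { adj-preserving = preserving ; injective = injective }
      where
      module Φ = IsJointEmbedding Φ-joint

      preserving : ∀ x y → adj (glue x) (glue y) ≡ adj x y
      preserving x y = by-cases (x ∈? Q) (y ∈? Q) (x ≟V y)
        where
        by-cases : Dec (x ∈ Q) → Dec (y ∈ Q) → Dec (x ≡ y) → adj (glue x) (glue y) ≡ adj x y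
        by-cases (yes x∈Q) (yes y∈Q) _        = cong₂ adj (glue-∈ x∈Q) (glue-∈ y∈Q)
        by-cases (yes x∈Q) (no y∉Q)  _        = glue-adj-mixed x∈Q y∉Q
        by-cases (no x∉Q)  (yes y∈Q) _        =
          trans (adj-sym (glue x) (glue y)) (trans (glue-adj-mixed y∈Q x∉Q) (adj-sym y x))
        by-cases (no _)    (no _)    (yes refl) = trans (adj-irrefl (glue x)) (sym (adj-irrefl x))
        by-cases (no x∉Q)  (no y∉Q)  (no x≢y) =
          trans (cong₂ adj (glue-∉ x∉Q) (glue-∉ y∉Q)) (Φ.adj-preserving _ _ x≢y)

      outside : ∀ {x y} → x ∈ Q → y ∉ Q → glue x ≢ glue y
      outside {x} {y} x∈Q y∉Q eq =
        proj₁ (Φ-typed (type Q y) y)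
          (subst (_∈ Q) (trans (sym (glue-∈ x∈Q)) (trans eq (glue-∉ y∉Q))) x∈Q)

      injective : Injective _≡_ _≡_ glue
      injective {x} {y} eq = by-cases (x ∈? Q) (y ∈? Q)
        where
        by-cases : Dec (x ∈ Q) → Dec (y ∈ Q) → x ≡ y
        by-cases (yes x∈Q) (yes y∈Q) = trans (sym (glue-∈ x∈Q)) (trans eq (glue-∈ y∈Q))
        by-cases (yes x∈Q) (no y∉Q)  = ⊥-elim (outside x∈Q y∉Q eq)
        by-cases (no x∉Q)  (yes y∈Q) = ⊥-elim (outside y∈Q x∉Q (sym eq))
        by-cases (no x∉Q)  (no y∉Q)  = Φ.injective _ _ (trans (sym (glue-∉ x∉Q)) (trans eq (glue-∉ y∉Q)))

    image-glue-∉ : ∀ {s} → Image glue s → s ∉ Q → ∃[ x ] Φ (type Q s) x ≡ s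
    image-glue-∉ {s} (x , glue-x≡s) s∉Q = x , subst (λ ρ → Φ ρ x ≡ s) type-x≡type-s Φx≡s
      where
      x∉Q : x ∉ Q
      x∉Q x∈Q = s∉Q (subst (_∈ Q) (trans (sym (glue-∈ x∈Q)) glue-x≡s) x∈Q)

      Φx≡s : Φ (type Q x) x ≡ s
      Φx≡s = trans (sym (glue-∉ x∉Q)) glue-x≡s

      type-x≡type-s : type Q x ≡ type Q s
      type-x≡type-s = trans (sym (proj₂ (Φ-typed (type Q x) x))) (cong (type Q) Φx≡s)

    image-glue∩Ext⊆ : ∀ {F H} {A : Pred V 0ℓ} → (∀ {x} → x ∈ F → x ∈ Q) → (∀ {x} → x ∈ Q → x ∈ F) →
      (∀ x → A (Φ (memberType Q H) x)) → Restrict G (Image glue) F H ⊆ A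
    image-glue∩Ext⊆ {A = A} F⊆Q Q⊆F Φ∈A (s∈image , ext@(s∉F , _))
      with image-glue-∉ s∈image (s∉F ∘ Q⊆F)
    ... | x , Φx≡s =
      subst A (trans (cong (λ ρ → Φ ρ x) (sym (Ext⇒type≡memberType Q Q⊆F ext))) Φx≡s) (Φ∈A x)

theorem4p2 : (G : CountableGraph) → IsRado G →
    (𝒜 : Pred (Pred (CountableGraph.V G) 0ℓ) 0ℓ) → IsMaximalAntichain G 𝒜 →
    (F₀ : List (CountableGraph.V G)) →
    ∃[ S ] (IsCopy G S
      × (∀ {x} → x ∈ F₀ → S x)
      × (∀ (H : List (CountableGraph.V G)) → _⊆ₗ_ G H F₀ →
           ∃[ A ] (𝒜 A × Restrict G S F₀ H ⊆ A)))
theorem4p2 G rado 𝒜 (_ , _ , maximal) F₀ =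
  Image glue , image-isCopy glue-isEmbedding , (λ x∈F₀ → _ , glue-∈ (F₀⊆Q x∈F₀)) , λ H _ →
    let (A , A∈𝒜 , Φ∈A) = absorbing (memberType Q H) in
    A , A∈𝒜 , image-glue∩Ext⊆ F₀⊆Q Q⊆F₀ Φ∈A
  where
  open RadoCopies G

  Q : List (CountableGraph.V G)
  Q = deduplicate _≟V_ F₀

  F₀⊆Q : ∀ {x} → x ∈ F₀ → x ∈ Q
  F₀⊆Q = ∈-deduplicate⁺ _≟V_

  Q⊆F₀ : ∀ {x} → x ∈ Q → x ∈ F₀
  Q⊆F₀ = ∈-deduplicate⁻ _≟V_ F₀

  open AbsorbingTypedEmbedding (absorbingTypedEmbedding rado 𝒜 maximal (deduplicate-! _≟V_ F₀))
  open Gluing Q joint typed
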